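{- Let $G$ be a connected graph and $x\in V(G)$ a vertex such that $G-x$ is connected. Then $\mu(G-x)\le 2\,\mu(G)$.
   Context: All graphs are finite, simple and connected; $G-x$ is the graph obtained by deleting $x$ and its incident edges. For a connected graph $G$ and $X\subseteq V(G)$, two vertices $u,v$ are $X$-visible if there is a shortest $u,v$-path $P$ in $G$ with $V(P)\cap X\subseteq\{u,v\}$. $X$ is a mutual-visibility set if every two $u,v\in X$ are $X$-visible; $\mu(G)$ is the maximum cardinality of a mutual-visibility set in $G$. -}

module Defs where

open import Data.Nat using (ℕ; zero; suc; _≤_)
open import Data.Fin using (Fin; punchIn)
open import Data.Fin.Subset using (Subset; _∈_; ∣_∣)
open import Data.List using (List; []; _∷_; length; head; last)
open import Data.List.Relation.Unary.All using (All)
open import Data.List.Relation.Unary.Unique.Propositional using (Unique)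
open import Data.Maybe using (just)
open import Data.Product using (Σ; _×_; ∃)
open import Data.Sum using (_⊎_)
open import Relation.Binary.PropositionalEquality using (_≡_)
open import Relation.Nullary using (¬_)

record Graph (n : ℕ) : Set₁ where
  field
    Adj     : Fin n → Fin n → Set
    sym     : ∀ {u v} → Adj u v → Adj v u
    irrefl  : ∀ {u} → ¬ Adj u u

open Graph public

data IsWalk {n : ℕ} (G : Graph n) : List (Fin n) → Set where
  single : ∀ v → IsWalk G (v ∷ [])
  step   : ∀ {u v vs} → Adj G u v → IsWalk G (v ∷ vs) → IsWalk G (u ∷ v ∷ vs)

record Path {n : ℕ} (G : Graph n) (u v : Fin n) : Set where
  field
    verts  : List (Fin n)
    walk   : IsWalk G verts
    unique : Unique verts
    start  : head verts ≡ just u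
    end    : last verts ≡ just v

open Path public

-- length (number of edges) + 1 = number of vertices; we compare vertex counts.
pathLen : ∀ {n} {G : Graph n} {u v} → Path G u v → ℕ
pathLen P = length (verts P)

IsShortest : ∀ {n} {G : Graph n} {u v} → Path G u v → Set
IsShortest {G = G} {u} {v} P = ∀ (Q : Path G u v) → pathLen P ≤ pathLen Q

Connected : ∀ {n} → Graph n → Set
Connected G = ∀ u v → Path G u v

deleteVertex : ∀ {n} → Graph (suc n) → Fin (suc n) → Graph n
deleteVertex G x = record
  { Adj    = λ u v → Adj G (punchIn x u) (punchIn x v)
  ; sym    = sym G
  ; irrefl = irrefl G
  }

Visible : ∀ {n} (G : Graph n) (X : Subset n) (u v : Fin n) → Set
Visible G X u v = Σ (Path G u v) λ P → IsShortest P ×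
  All (λ w → w ∈ X → (w ≡ u ⊎ w ≡ v)) (verts P)

IsMutualVisibilitySet : ∀ {n} → Graph n → Subset n → Set
IsMutualVisibilitySet G X = ∀ u v → u ∈ X → v ∈ X → Visible G X u v

IsMu : ∀ {n} → Graph n → ℕ → Set
IsMu G m = (Σ _ λ X → IsMutualVisibilitySet G X × ∣ X ∣ ≡ m)
         × (∀ X → IsMutualVisibilitySet G X → ∣ X ∣ ≤ m)

-- Let X be a maximum mutual-visibility set of G − x, viewed inside G, and split it into the
-- vertices that see x (along a geodesic of G meeting X in no other vertex) and the rest.
-- Each part is a mutual-visibility set of G, so ∣X∣ ≤ 2 μ(G). Two vertices of a part are
-- joined either by their geodesic of G − x, if it is still a geodesic of G, or else by the
-- concatenation of their geodesics to x. A vertex that does not see x still has a suitable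
-- geodesic to x: follow any geodesic to x up to its last vertex c of X, and replace the
-- segment before c by a geodesic of G − x along which the two are X-visible; then c sees x,
-- so c lies in the other part.
-- The conclusion is decidable, so the classical choices (existence of geodesics, whether a
-- vertex sees x) are made under double negation.
module Submission where

open import Defs
open import Data.Nat using (ℕ; zero; suc; _+_; _*_; _≤_; _<_; z≤n; s≤s; _≤?_)
open import Data.Nat.Properties
  using (≤-refl; ≤-trans; ≤-reflexive; ≤-total; ≤-pred; ≮⇒≥; <⇒≱; +-mono-≤; +-monoˡ-≤; +-monoʳ-≤;
         +-cancelˡ-≤; +-comm; +-suc; +-identityʳ; m≤m+n; m≤n+m; module ≤-Reasoning)
open import Data.Fin using (Fin; zero; suc; punchIn; punchOut; _≟_)
open import Data.Fin.Properties using (punchIn-injective; punchIn-punchOut; sequence)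
open import Data.Fin.Subset using (Subset; _∈_; _∉_; _⊆_; ∣_∣; _∩_; _─_; inside; outside)
open import Data.Fin.Subset.Properties using (p∩q⊆p; x∈p∩q⁻; p─q⊆p; _∈?_)
open import Data.Vec using ([]; _∷_; here; there; insertAt)
open import Data.Vec.Properties using (insertAt-lookup; insertAt-punchIn; []=⇒lookup; lookup⇒[]=)
open import Data.List using (List; []; _∷_; length; map; head; last)
open import Data.List.Relation.Unary.All using ([]) renaming (tabulate to All-tabulate; lookup to All-lookup)
open import Data.List.Relation.Unary.All.Properties using (¬Any⇒All¬)
open import Data.List.Relation.Unary.Any using (Any; here; there; any?)
open import Data.List.Relation.Unary.AllPairs using ([]; _∷_)
open import Data.List.Relation.Unary.Unique.Propositional using (Unique)
open import Data.List.Membership.Propositional using (lose) renaming (_∈_ to _∈ₗ_; _∉_ to _∉ₗ_)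
open import Data.List.Membership.Propositional.Properties using (∈-map⁻)
open import Data.Maybe using (just)
open import Data.Product using (Σ; ∃; _×_; _,_; proj₁; proj₂)
open import Data.Sum using (_⊎_; inj₁; inj₂; [_,_]) renaming (map to ⊎-map; map₁ to ⊎-map₁)
open import Effect.Monad using (RawMonad)
open import Function using (_∘_; id)
open import Level using (0ℓ)
open import Relation.Nullary using (¬_; yes; no; does)
open import Relation.Nullary.Decidable using (decidable-stable; ¬¬-excluded-middle)
open import Relation.Nullary.Negation using (DoubleNegation; ¬¬-Monad; contradiction)
open import Relation.Unary using (Pred; Decidable)
open import Relation.Binary.PropositionalEquality
  using (_≡_; _≢_; refl; cong; subst; trans; module ≡-Reasoning) renaming (sym to ≡-sym)

open RawMonad (¬¬-Monad {0ℓ}) using (pure; _>>=_; rawApplicative)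

-- Walks and geodesics

infixr 5 _◅_

data Walk {n : ℕ} (G : Graph n) : Fin n → Fin n → Set where
  ε   : ∀ {v} → Walk G v v
  _◅_ : ∀ {u v w} → Adj G u v → Walk G v w → Walk G u w

module _ {n : ℕ} {G : Graph n} where

  infixr 5 _◅◅_

  vertices : ∀ {a b} → Walk G a b → List (Fin n)
  vertices {a} ε       = a ∷ []
  vertices {a} (_ ◅ w) = a ∷ vertices w

  len : ∀ {a b} → Walk G a b → ℕ
  len ε       = 0
  len (_ ◅ w) = suc (len w)

  IsGeodesic : ∀ {a b} → Walk G a b → Set
  IsGeodesic {a} {b} w = ∀ (w′ : Walk G a b) → len w ≤ len w′

  length-vertices : ∀ {a b} (w : Walk G a b) → length (vertices w) ≡ suc (len w)
  length-vertices ε       = refl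
  length-vertices (_ ◅ w) = cong suc (length-vertices w)

  start∈vertices : ∀ {a b} (w : Walk G a b) → a ∈ₗ vertices w
  start∈vertices ε       = here refl
  start∈vertices (_ ◅ _) = here refl

  len-pos : ∀ {a b} → a ≢ b → (w : Walk G a b) → 1 ≤ len w
  len-pos a≢a ε = contradiction refl a≢a
  len-pos _ (_ ◅ _) = s≤s z≤n

  _◅◅_ : ∀ {a b c} → Walk G a b → Walk G b c → Walk G a c
  ε       ◅◅ q = q
  (e ◅ p) ◅◅ q = e ◅ (p ◅◅ q)

  len-◅◅ : ∀ {a b c} (p : Walk G a b) (q : Walk G b c) → len (p ◅◅ q) ≡ len p + len q
  len-◅◅ ε       q = refl
  len-◅◅ (_ ◅ p) q = cong suc (len-◅◅ p q)

  ∈-◅◅⁻ : ∀ {a b c z} (p : Walk G a b) (q : Walk G b c) →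
          z ∈ₗ vertices (p ◅◅ q) → z ∈ₗ vertices p ⊎ z ∈ₗ vertices q
  ∈-◅◅⁻ ε       q z∈        = inj₂ z∈
  ∈-◅◅⁻ (_ ◅ p) q (here eq) = inj₁ (here eq)
  ∈-◅◅⁻ (_ ◅ p) q (there z∈) = ⊎-map₁ there (∈-◅◅⁻ p q z∈)

  reverse : ∀ {a b} → Walk G a b → Walk G b a
  reverse ε       = ε
  reverse (e ◅ w) = reverse w ◅◅ (sym G e ◅ ε)

  len-reverse : ∀ {a b} (w : Walk G a b) → len (reverse w) ≡ len w
  len-reverse ε       = refl
  len-reverse (e ◅ w) = begin
    len (reverse w ◅◅ (sym G e ◅ ε)) ≡⟨ len-◅◅ (reverse w) (sym G e ◅ ε) ⟩
    len (reverse w) + 1              ≡⟨ +-comm (len (reverse w)) 1 ⟩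
    suc (len (reverse w))            ≡⟨ cong suc (len-reverse w) ⟩
    suc (len w)                      ∎
    where open ≡-Reasoning

  ∈-reverse⁻ : ∀ {a b z} (w : Walk G a b) → z ∈ₗ vertices (reverse w) → z ∈ₗ vertices w
  ∈-reverse⁻ ε z∈ = z∈
  ∈-reverse⁻ (e ◅ w) z∈ with ∈-◅◅⁻ (reverse w) (sym G e ◅ ε) z∈
  ... | inj₁ z∈w                 = there (∈-reverse⁻ w z∈w)
  ... | inj₂ (here refl)         = there (start∈vertices w)
  ... | inj₂ (there (here refl)) = here refl

  split : ∀ {a b c} (w : Walk G a b) → c ∈ₗ vertices w →
          Σ (Walk G a c) λ p → Σ (Walk G c b) λ q → w ≡ p ◅◅ q
  split ε       (here refl) = ε , ε , refl
  split (e ◅ w) (here refl) = ε , e ◅ w , refl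
  split (e ◅ w) (there c∈) with split w c∈
  ... | p , q , refl = e ◅ p , q , refl

  record SplitAtLast (Q : Pred (Fin n) 0ℓ) {a b} (w : Walk G a b) : Set where
    field
      {pivot} : Fin n
      Q-pivot : Q pivot
      prefix  : Walk G a pivot
      suffix  : Walk G pivot b
      splits  : w ≡ prefix ◅◅ suffix
      pivot-last : ∀ {z} → z ∈ₗ vertices suffix → Q z → z ≡ pivot

  splitAtLast : ∀ {Q : Pred (Fin n) 0ℓ} → Decidable Q →
                ∀ {a b} (w : Walk G a b) → Any Q (vertices w) → SplitAtLast Q w
  splitAtLast Q? ε (here Qa) = record
    { Q-pivot = Qa ; prefix = ε ; suffix = ε ; splits = refl
    ; pivot-last = λ { (here refl) _ → refl } }
  splitAtLast Q? (e ◅ w) Q∈ with any? Q? (vertices w)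
  ... | yes Q∈w = record
    { Q-pivot = Q-pivot ; prefix = e ◅ prefix ; suffix = suffix
    ; splits = cong (e ◅_) splits ; pivot-last = pivot-last }
    where open SplitAtLast (splitAtLast Q? w Q∈w)
  ... | no Q∉w with Q∈
  ...   | there Q∈w = contradiction Q∈w Q∉w
  ...   | here Qa = record
    { Q-pivot = Qa ; prefix = ε ; suffix = e ◅ w ; splits = refl
    ; pivot-last = λ { (here refl) _ → refl ; (there z∈) Qz → contradiction (lose z∈ Qz) Q∉w } }

  geodesic-≤ : ∀ {a b} {w w′ : Walk G a b} → IsGeodesic w → len w′ ≤ len w → IsGeodesic w′
  geodesic-≤ geo w′≤w w″ = ≤-trans w′≤w (geo w″)

  geodesic-suffix : ∀ {a b c} (p : Walk G a b) (q : Walk G b c) → IsGeodesic (p ◅◅ q) → IsGeodesic q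
  geodesic-suffix p q geo q′ = +-cancelˡ-≤ (len p) (len q) (len q′) (begin
    len p + len q    ≡⟨ len-◅◅ p q ⟨
    len (p ◅◅ q)     ≤⟨ geo (p ◅◅ q′) ⟩
    len (p ◅◅ q′)    ≡⟨ len-◅◅ p q′ ⟩
    len p + len q′   ∎)
    where open ≤-Reasoning

  geodesic-reverse : ∀ {a b} {w : Walk G a b} → IsGeodesic w → IsGeodesic (reverse w)
  geodesic-reverse {w = w} geo w′ = begin
    len (reverse w)  ≡⟨ len-reverse w ⟩
    len w            ≤⟨ geo (reverse w′) ⟩
    len (reverse w′) ≡⟨ len-reverse w′ ⟩
    len w′           ∎
    where open ≤-Reasoning

  len-via : ∀ {a b c} {s : Walk G a c} {t : Walk G c b} → IsGeodesic s → IsGeodesic t →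
            (w : Walk G a b) → c ∈ₗ vertices w → len s + len t ≤ len w
  len-via s-geo t-geo w c∈ with split w c∈
  ... | p , q , refl = ≤-trans (+-mono-≤ (s-geo p) (t-geo q)) (≤-reflexive (≡-sym (len-◅◅ p q)))

  geodesic-start∉ : ∀ {a c b} (e : Adj G a c) (w : Walk G c b) → IsGeodesic (e ◅ w) → a ∉ₗ vertices w
  geodesic-start∉ e w geo a∈ with split w a∈
  ... | p , q , refl = <⇒≱ (s≤s (begin
    len q          ≤⟨ m≤n+m (len q) (len p) ⟩
    len p + len q  ≡⟨ len-◅◅ p q ⟨
    len (p ◅◅ q)   ∎)) (geo q)
    where open ≤-Reasoning

  geodesic-end∉prefix : ∀ {a c b} (p : Walk G a c) (q : Walk G c b) → IsGeodesic (p ◅◅ q) →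
                        1 ≤ len q → b ∉ₗ vertices p
  geodesic-end∉prefix p q geo 1≤q b∈ with split p b∈
  ... | p₁ , p₂ , refl = <⇒≱ (begin-strict
    len p₁                       ≤⟨ m≤m+n (len p₁) (len p₂) ⟩
    len p₁ + len p₂              ≡⟨ len-◅◅ p₁ p₂ ⟨
    len (p₁ ◅◅ p₂)               <⟨ ≤-trans (≤-reflexive (+-comm 1 _)) (+-monoʳ-≤ (len (p₁ ◅◅ p₂)) 1≤q) ⟩
    len (p₁ ◅◅ p₂) + len q       ≡⟨ len-◅◅ (p₁ ◅◅ p₂) q ⟨
    len ((p₁ ◅◅ p₂) ◅◅ q)        ∎)
    (geo p₁)
    where open ≤-Reasoning

  geodesic⇒unique : ∀ {a b} (w : Walk G a b) → IsGeodesic w → Unique (vertices w)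
  geodesic⇒unique ε       _   = [] ∷ []
  geodesic⇒unique (e ◅ w) geo =
    ¬Any⇒All¬ (vertices w) (geodesic-start∉ e w geo) ∷
    geodesic⇒unique w (geodesic-suffix (e ◅ ε) w geo)

  geodesic-min : ∀ {a b} (w₁ w₂ : Walk G a b) → (∀ w′ → len w₁ ≤ len w′ ⊎ len w₂ ≤ len w′) →
                 IsGeodesic w₁ ⊎ IsGeodesic w₂
  geodesic-min w₁ w₂ bound with ≤-total (len w₁) (len w₂)
  ... | inj₁ w₁≤w₂ = inj₁ λ w′ → [ id , ≤-trans w₁≤w₂ ] (bound w′)
  ... | inj₂ w₂≤w₁ = inj₂ λ w′ → [ ≤-trans w₂≤w₁ , id ] (bound w′)

  geodesic-exists : ∀ {a b} → Walk G a b → DoubleNegation (Σ (Walk G a b) IsGeodesic)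
  geodesic-exists w = below (len w) w ≤-refl
    where
    below : ∀ {a b} k (w : Walk G a b) → len w ≤ k → DoubleNegation (Σ (Walk G a b) IsGeodesic)
    below zero    w w≤0 = pure (w , λ w′ → ≤-trans w≤0 z≤n)
    below {a} {b} (suc k) w w≤k =
      ¬¬-excluded-middle {A = ∃ λ (w′ : Walk G a b) → len w′ < len w} >>= λ where
        (yes (w′ , w′<w)) → below k w′ (≤-pred (≤-trans w′<w w≤k))
        (no ∄shorter)     → pure (w , λ w′ → ≮⇒≥ λ w′<w → ∄shorter (w′ , w′<w))

  walkOf : ∀ {a b vs} → IsWalk G vs → head vs ≡ just a → last vs ≡ just b →
           Σ (Walk G a b) λ w → vertices w ≡ vs
  walkOf (single _) refl refl = ε , refl
  walkOf {a} (step e iw) refl end with walkOf iw refl end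
  ... | w , w≡vs = e ◅ w , cong (a ∷_) w≡vs

  pathWalk : ∀ {a b} (P : Path G a b) → Σ (Walk G a b) λ w → vertices w ≡ verts P
  pathWalk P = walkOf (walk P) (start P) (end P)

  len-pathWalk : ∀ {a b} (P : Path G a b) → suc (len (proj₁ (pathWalk P))) ≡ pathLen P
  len-pathWalk P = trans (≡-sym (length-vertices (proj₁ (pathWalk P)))) (cong length (proj₂ (pathWalk P)))

  geodesicPath : ∀ {a b} (w : Walk G a b) → IsGeodesic w → Path G a b
  geodesicPath w geo = record
    { verts = vertices w ; walk = isWalk w ; unique = geodesic⇒unique w geo
    ; start = head-vertices w ; end = last-vertices w }
    where
    isWalk : ∀ {a b} (w : Walk G a b) → IsWalk G (vertices w)
    isWalk ε               = single _
    isWalk (e ◅ ε)         = step e (single _)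
    isWalk (e ◅ e′ ◅ w)    = step e (isWalk (e′ ◅ w))

    head-vertices : ∀ {a b} (w : Walk G a b) → head (vertices w) ≡ just a
    head-vertices ε       = refl
    head-vertices (_ ◅ _) = refl

    last-vertices : ∀ {a b} (w : Walk G a b) → last (vertices w) ≡ just b
    last-vertices ε            = refl
    last-vertices (_ ◅ ε)      = refl
    last-vertices (_ ◅ e ◅ w)  = last-vertices (e ◅ w)

  geodesic⇒shortest : ∀ {a b} (w : Walk G a b) (geo : IsGeodesic w) → IsShortest (geodesicPath w geo)
  geodesic⇒shortest w geo Q = begin
    length (vertices w)                ≡⟨ length-vertices w ⟩
    suc (len w)                        ≤⟨ s≤s (geo (proj₁ (pathWalk Q))) ⟩
    suc (len (proj₁ (pathWalk Q)))     ≡⟨ len-pathWalk Q ⟩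
    pathLen Q                          ∎
    where open ≤-Reasoning

  -- Shortest paths are only compared with paths, so comparing with an arbitrary walk goes
  -- through a geodesic below it, which is a path.
  shortest⇒geodesic : ∀ {a b} (P : Path G a b) → IsShortest P → IsGeodesic (proj₁ (pathWalk P))
  shortest⇒geodesic P shortest w′ = decidable-stable (_ ≤? _) do
    g , g-geo ← geodesic-exists w′
    pure (≤-trans (≤-pred (begin
      suc (len (proj₁ (pathWalk P)))  ≡⟨ len-pathWalk P ⟩
      pathLen P                       ≤⟨ shortest (geodesicPath g g-geo) ⟩
      length (vertices g)             ≡⟨ length-vertices g ⟩
      suc (len g)                     ∎)) (g-geo w′))
    where open ≤-Reasoning

VisibleWalk : ∀ {n} → Graph n → Subset n → Fin n → Fin n → Set
VisibleWalk G Y a b =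
  Σ (Walk G a b) λ w → IsGeodesic w × (∀ {z} → z ∈ₗ vertices w → z ∈ Y → z ≡ a ⊎ z ≡ b)

Sees : ∀ {n} → Graph n → Subset n → Fin n → Fin n → Set
Sees G Y a b = Σ (Walk G a b) λ w → IsGeodesic w × (∀ {z} → z ∈ₗ vertices w → z ∈ Y → z ≡ a)

module _ {n : ℕ} {G : Graph n} {Y : Subset n} where

  Visible⇒VisibleWalk : ∀ {a b} → Visible G Y a b → VisibleWalk G Y a b
  Visible⇒VisibleWalk (P , shortest , clear) =
    proj₁ (pathWalk P) , shortest⇒geodesic P shortest ,
    λ {z} z∈ → All-lookup clear (subst (z ∈ₗ_) (proj₂ (pathWalk P)) z∈)

  VisibleWalk⇒Visible : ∀ {a b} → VisibleWalk G Y a b → Visible G Y a b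
  VisibleWalk⇒Visible (w , geo , clear) =
    geodesicPath w geo , geodesic⇒shortest w geo , All-tabulate clear

  Sees-antimono : ∀ {Z a b} → Y ⊆ Z → Sees G Z a b → Sees G Y a b
  Sees-antimono Y⊆Z (w , geo , clear) = w , geo , λ z∈ z∈Y → clear z∈ (Y⊆Z z∈Y)

subset : ∀ {k} {P : Pred (Fin k) 0ℓ} → Decidable P → Subset k
subset {zero}  P? = []
subset {suc k} P? = does (P? zero) ∷ subset (P? ∘ suc)

∈-subset⁺ : ∀ {k} {P : Pred (Fin k) 0ℓ} (P? : Decidable P) {i} → P i → i ∈ subset P?
∈-subset⁺ P? {zero} Pi with P? zero
... | yes _  = here
... | no ¬Pi = contradiction Pi ¬Pi
∈-subset⁺ P? {suc i} Pi = there (∈-subset⁺ (P? ∘ suc) Pi)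

∈-subset⁻ : ∀ {k} {P : Pred (Fin k) 0ℓ} (P? : Decidable P) {i} → i ∈ subset P? → P i
∈-subset⁻ P? {zero} i∈ with P? zero | i∈
... | yes Pi | _ = Pi
... | no _   | ()
∈-subset⁻ P? {suc i} (there i∈) = ∈-subset⁻ (P? ∘ suc) i∈

x∈p─q⇒x∉q : ∀ {k} (p q : Subset k) {i} → i ∈ p ─ q → i ∉ q
x∈p─q⇒x∉q (inside ∷ p) (outside ∷ q) here       ()
x∈p─q⇒x∉q (_ ∷ p)      (_ ∷ q)       (there i∈) (there i∈q) = x∈p─q⇒x∉q p q i∈ i∈q

∣p∩q∣+∣p─q∣≡∣p∣ : ∀ {k} (p q : Subset k) → ∣ p ∩ q ∣ + ∣ p ─ q ∣ ≡ ∣ p ∣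
∣p∩q∣+∣p─q∣≡∣p∣ []            []            = refl
∣p∩q∣+∣p─q∣≡∣p∣ (inside ∷ p)  (inside ∷ q)  = cong suc (∣p∩q∣+∣p─q∣≡∣p∣ p q)
∣p∩q∣+∣p─q∣≡∣p∣ (inside ∷ p)  (outside ∷ q) = trans (+-suc _ _) (cong suc (∣p∩q∣+∣p─q∣≡∣p∣ p q))
∣p∩q∣+∣p─q∣≡∣p∣ (outside ∷ p) (inside ∷ q)  = ∣p∩q∣+∣p─q∣≡∣p∣ p q
∣p∩q∣+∣p─q∣≡∣p∣ (outside ∷ p) (outside ∷ q) = ∣p∩q∣+∣p─q∣≡∣p∣ p q

-- Deleting a vertex

module Deletion {n : ℕ} (G : Graph (suc n)) (x : Fin (suc n)) where

  H : Graph n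
  H = deleteVertex G x

  ι : Fin n → Fin (suc n)
  ι = punchIn x

  ι-onto : ∀ {z} → z ≢ x → ∃ λ w → z ≡ ι w
  ι-onto z≢x = punchOut (z≢x ∘ ≡-sym) , ≡-sym (punchIn-punchOut _)

  lift : ∀ {u v} → Walk H u v → Walk G (ι u) (ι v)
  lift ε       = ε
  lift (e ◅ h) = e ◅ lift h

  len-lift : ∀ {u v} (h : Walk H u v) → len (lift h) ≡ len h
  len-lift ε       = refl
  len-lift (_ ◅ h) = cong suc (len-lift h)

  vertices-lift : ∀ {u v} (h : Walk H u v) → vertices (lift h) ≡ map ι (vertices h)
  vertices-lift ε       = refl
  vertices-lift (_ ◅ h) = cong (ι _ ∷_) (vertices-lift h)

  ∈-lift⁻ : ∀ {u v z} (h : Walk H u v) → z ∈ₗ vertices (lift h) → ∃ λ w → w ∈ₗ vertices h × z ≡ ι w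
  ∈-lift⁻ h z∈ = ∈-map⁻ ι (subst (_ ∈ₗ_) (vertices-lift h) z∈)

  unlift : ∀ {a b} (w : Walk G a b) → x ∉ₗ vertices w → ∀ {u v} → ι u ≡ a → ι v ≡ b →
           Σ (Walk H u v) λ h → len h ≡ len w
  unlift ε _ {u} {v} refl ιv≡ιu with punchIn-injective x v u ιv≡ιu
  ... | refl = ε , refl
  unlift (_◅_ {v = c} e w) x∉ refl ιv≡b
    with ι-onto {c} (λ c≡x → x∉ (there (subst (_∈ₗ vertices w) c≡x (start∈vertices w))))
  ... | c′ , refl with unlift w (x∉ ∘ there) refl ιv≡b
  ...   | h , len-h = e ◅ h , cong suc len-h

  liftˢ : Subset n → Subset (suc n)
  liftˢ S = insertAt S x outside

  ∈-liftˢ⁻ : ∀ {S w} → ι w ∈ liftˢ S → w ∈ S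
  ∈-liftˢ⁻ {S} {w} ιw∈ = lookup⇒[]= w S (trans (≡-sym (insertAt-punchIn S x outside w)) ([]=⇒lookup ιw∈))

  x∉liftˢ : ∀ {S} → x ∉ liftˢ S
  x∉liftˢ {S} x∈ with trans (≡-sym (insertAt-lookup S x outside)) ([]=⇒lookup x∈)
  ... | ()

  liftˢ-image : ∀ {S z} → z ∈ liftˢ S → ∃ λ w → z ≡ ι w
  liftˢ-image {S} z∈ = ι-onto λ { refl → x∉liftˢ {S} z∈ }

  ∣liftˢ∣ : ∀ S → ∣ liftˢ S ∣ ≡ ∣ S ∣
  ∣liftˢ∣ S = ∣insertAt-outside∣ S x
    where
    ∣insertAt-outside∣ : ∀ {k} (S : Subset k) (i : Fin (suc k)) → ∣ insertAt S i outside ∣ ≡ ∣ S ∣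
    ∣insertAt-outside∣ S            zero    = refl
    ∣insertAt-outside∣ (inside ∷ S)  (suc i) = cong suc (∣insertAt-outside∣ S i)
    ∣insertAt-outside∣ (outside ∷ S) (suc i) = ∣insertAt-outside∣ S i

  relift-geodesic : ∀ {u c b} (p : Walk G (ι u) (ι c)) (q : Walk G (ι c) b) →
                    IsGeodesic (p ◅◅ q) → x ∉ₗ vertices p →
                    (h : Walk H u c) → IsGeodesic h → IsGeodesic (lift h ◅◅ q)
  relift-geodesic p q pq-geo x∉p h h-geo with unlift p x∉p refl refl
  ... | p′ , len-p′ = geodesic-≤ pq-geo (begin
    len (lift h ◅◅ q)     ≡⟨ len-◅◅ (lift h) q ⟩
    len (lift h) + len q  ≡⟨ cong (_+ len q) (len-lift h) ⟩
    len h + len q         ≤⟨ +-monoˡ-≤ (len q) (h-geo p′) ⟩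
    len p′ + len q        ≡⟨ cong (_+ len q) len-p′ ⟩
    len p + len q         ≡⟨ len-◅◅ p q ⟨
    len (p ◅◅ q)          ∎)
    where open ≤-Reasoning

module MutualVisibility {n : ℕ} (G : Graph (suc n)) (x : Fin (suc n)) {X : Subset n}
  (X-mv : IsMutualVisibilitySet (deleteVertex G x) X) where

  open Deletion G x
  open import Data.List.Membership.DecPropositional (_≟_ {suc n}) using () renaming (_∈?_ to _∈ₗ?_)

  L : Subset (suc n)
  L = liftˢ X

  X-visible : ∀ {u v} → u ∈ X → v ∈ X → VisibleWalk H X u v
  X-visible u∈ v∈ = Visible⇒VisibleWalk (X-mv _ _ u∈ v∈)

  mutual-visibility-lift : ∀ {Y} → Y ⊆ L → (∀ {a} → a ∈ Y → Sees G Y a x) →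
                           IsMutualVisibilitySet G Y
  mutual-visibility-lift {Y} Y⊆L sees a b a∈Y b∈Y
    with liftˢ-image (Y⊆L a∈Y) | liftˢ-image (Y⊆L b∈Y)
  ... | u , refl | v , refl = VisibleWalk⇒Visible (visible (geodesic-min (lift h) detour shorter))
    where
    h-visible : VisibleWalk H X u v
    h-visible = X-visible (∈-liftˢ⁻ (Y⊆L a∈Y)) (∈-liftˢ⁻ (Y⊆L b∈Y))

    h : Walk H u v
    h = proj₁ h-visible

    sa : Sees G Y (ι u) x
    sa = sees a∈Y

    sb : Sees G Y (ι v) x
    sb = sees b∈Y

    detour : Walk G (ι u) (ι v)
    detour = proj₁ sa ◅◅ reverse (proj₁ sb)

    shorter : ∀ w → len (lift h) ≤ len w ⊎ len detour ≤ len w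
    shorter w with x ∈ₗ? vertices w
    ... | yes x∈w = inj₂ (≤-trans (≤-reflexive (len-◅◅ (proj₁ sa) (reverse (proj₁ sb))))
                                  (len-via (proj₁ (proj₂ sa)) (geodesic-reverse (proj₁ (proj₂ sb))) w x∈w))
    ... | no x∉w with unlift w x∉w refl refl
    ...   | h′ , len-h′ = inj₁ (≤-trans (≤-reflexive (len-lift h))
                                        (≤-trans (proj₁ (proj₂ h-visible) h′) (≤-reflexive len-h′)))

    visible : IsGeodesic (lift h) ⊎ IsGeodesic detour → VisibleWalk G Y (ι u) (ι v)
    visible (inj₁ geo) = lift h , geo , λ z∈ z∈Y → lifted-clear (∈-lift⁻ h z∈) z∈Y
      where
      lifted-clear : ∀ {z} → ∃ (λ w → w ∈ₗ vertices h × z ≡ ι w) → z ∈ Y → z ≡ ι u ⊎ z ≡ ι v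
      lifted-clear (w , w∈ , refl) ιw∈Y =
        ⊎-map (cong ι) (cong ι) (proj₂ (proj₂ h-visible) w∈ (∈-liftˢ⁻ (Y⊆L ιw∈Y)))
    visible (inj₂ geo) = detour , geo , λ z∈ z∈Y →
      ⊎-map (λ z∈a → proj₂ (proj₂ sa) z∈a z∈Y)
            (λ z∈b → proj₂ (proj₂ sb) (∈-reverse⁻ (proj₁ sb) z∈b) z∈Y)
            (∈-◅◅⁻ (proj₁ sa) (reverse (proj₁ sb)) z∈)

  blind-sees-apex : ∀ {Y} → Y ⊆ L → (∀ {c} → c ∈ Y → ¬ Sees G L c x) →
                    ∀ {a} → a ∈ Y → Σ (Walk G a x) IsGeodesic → Sees G Y a x
  blind-sees-apex {Y} Y⊆L blind a∈Y (T , T-geo) with liftˢ-image (Y⊆L a∈Y)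
  ... | u , refl = via-pivot (splitAtLast (_∈? L) T (lose (start∈vertices T) (Y⊆L a∈Y)))
    where
    via-pivot : SplitAtLast (_∈ L) T → Sees G Y (ι u) x
    via-pivot record { pivot = pv ; Q-pivot = pv∈L ; prefix = p ; suffix = q
                     ; splits = T≡pq ; pivot-last = q-clear }
      with liftˢ-image pv∈L
    ... | c , refl = lift h ◅◅ q , relift-geodesic p q pq-geo x∉p h (proj₁ (proj₂ h-visible)) , clear
      where
      pq-geo : IsGeodesic (p ◅◅ q)
      pq-geo = subst IsGeodesic T≡pq T-geo

      c∉Y : ι c ∉ Y
      c∉Y c∈Y = blind c∈Y (q , geodesic-suffix p q pq-geo , q-clear)

      x∉p : x ∉ₗ vertices p
      x∉p = geodesic-end∉prefix p q pq-geo (len-pos (λ c≡x → x∉liftˢ {X} (subst (_∈ L) c≡x pv∈L)) q)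

      h-visible : VisibleWalk H X u c
      h-visible = X-visible (∈-liftˢ⁻ (Y⊆L a∈Y)) (∈-liftˢ⁻ pv∈L)

      h : Walk H u c
      h = proj₁ h-visible

      clear : ∀ {z} → z ∈ₗ vertices (lift h ◅◅ q) → z ∈ Y → z ≡ ι u
      clear z∈ z∈Y with ∈-◅◅⁻ (lift h) q z∈
      ... | inj₂ z∈q = contradiction (subst (_∈ Y) (q-clear z∈q (Y⊆L z∈Y)) z∈Y) c∉Y
      ... | inj₁ z∈h with ∈-lift⁻ h z∈h
      ...   | w , w∈h , refl with proj₂ (proj₂ h-visible) w∈h (∈-liftˢ⁻ (Y⊆L z∈Y))
      ...     | inj₁ w≡u  = cong ι w≡u
      ...     | inj₂ refl = contradiction z∈Y c∉Y

  ∣X∣≤2*μ : (∀ a → Σ (Walk G a x) IsGeodesic) → Decidable (λ a → Sees G L a x) →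
            ∀ {m′} → (∀ Y → IsMutualVisibilitySet G Y → ∣ Y ∣ ≤ m′) → ∣ X ∣ ≤ 2 * m′
  ∣X∣≤2*μ geodesic-to-x sees? {m′} maximal = begin
    ∣ X ∣                      ≡⟨ ∣liftˢ∣ X ⟨
    ∣ L ∣                      ≡⟨ ∣p∩q∣+∣p─q∣≡∣p∣ L S ⟨
    ∣ L ∩ S ∣ + ∣ L ─ S ∣      ≤⟨ +-mono-≤ (maximal _ seers-mv) (maximal _ blind-mv) ⟩
    m′ + m′                    ≡⟨ cong (m′ +_) (+-identityʳ m′) ⟨
    2 * m′                     ∎
    where
    open ≤-Reasoning

    S : Subset (suc n)
    S = subset sees?

    seers-mv : IsMutualVisibilitySet G (L ∩ S)
    seers-mv = mutual-visibility-lift (p∩q⊆p L S) λ a∈ →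
      Sees-antimono (p∩q⊆p L S) (∈-subset⁻ sees? (proj₂ (x∈p∩q⁻ L S a∈)))

    blind-mv : IsMutualVisibilitySet G (L ─ S)
    blind-mv = mutual-visibility-lift (p─q⊆p L S) λ a∈ →
      blind-sees-apex (p─q⊆p L S) (λ c∈ sees → x∈p─q⇒x∉q L S c∈ (∈-subset⁺ sees? sees)) a∈ (geodesic-to-x _)

theorem5p5 : ∀ {n : ℕ} (G : Graph (suc n)) (x : Fin (suc n)) →
    Connected G → Connected (deleteVertex G x) →
    ∀ (m m′ : ℕ) → IsMu (deleteVertex G x) m → IsMu G m′ → m ≤ 2 * m′
theorem5p5 G x connected _ m m′ ((X , X-mv , ∣X∣≡m) , _) (_ , maximal) =
  subst (_≤ 2 * m′) ∣X∣≡m (decidable-stable (_ ≤? _) do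
    geodesic-to-x ← sequence rawApplicative λ a → geodesic-exists (proj₁ (pathWalk (connected a x)))
    sees? ← sequence rawApplicative λ _ → ¬¬-excluded-middle
    pure (MutualVisibility.∣X∣≤2*μ G x X-mv geodesic-to-x sees? maximal))
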